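{- Let $k\in\{1,\dots,\bar{n}-1\}$. If $L$ is a $\bar{d}$ regular graph on $\bar{n}$ vertices, but not complete, which contains a clique of size $c$, then $\mathfrak{L}_k$ contains a clique of size $c$.
   Context: For a finite simple graph $L=(V,E)$ and $k\in\{1,\dots,|V|-1\}$, the $k$-particle graph $\mathfrak{L}_k=(\mathfrak{V}_k,\mathfrak{E}_k)$ has vertex set $\mathfrak{V}_k$ consisting of all subsets of $V$ of size $k$, and $\langle\mathfrak{v},\mathfrak{w}\rangle\in\mathfrak{E}_k$ if and only if $\mathfrak{v}\triangle\mathfrak{w}=\{v,w\}$ with $\langle v,w\rangle\in E$. $L$ is assumed simple and connected. -}

module Defs where

open import Data.Nat using (ℕ; suc)
open import Data.Bool using (Bool; true; false; T)
open import Data.Fin using (Fin)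
open import Data.Fin.Subset using (Subset; _∈_; _∉_; ∣_∣)
open import Data.List using (length; filter)
open import Data.List using () renaming (allFin to allFinL)
open import Data.Product using (Σ; ∃; _×_; _,_; proj₁)
open import Data.Empty using (⊥)
open import Relation.Nullary using (¬_)
open import Relation.Nullary.Decidable using (T?)
open import Relation.Binary.PropositionalEquality using (_≡_; _≢_)
open import Function.Bundles using (_⇔_)

record SimpleGraph (n : ℕ) : Set where
  field
    adj       : Fin n → Fin n → Bool
    irrefl    : ∀ v → adj v v ≡ false
    symmetric : ∀ v w → adj v w ≡ adj w v

open SimpleGraph public

Adj : ∀ {n} → SimpleGraph n → Fin n → Fin n → Set
Adj G v w = T (adj G v w)

data Reachable {n : ℕ} (G : SimpleGraph n) : Fin n → Fin n → Set where
  here : ∀ {v} → Reachable G v v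
  step : ∀ {u v w} → Adj G u v → Reachable G v w → Reachable G u w

Connected : ∀ {n} → SimpleGraph n → Set
Connected G = ∀ v w → Reachable G v w

degree : ∀ {n} → SimpleGraph n → Fin n → ℕ
degree {n} G v = length (filter (λ w → T? (adj G v w)) (allFinL n))

Regular : ∀ {n} → SimpleGraph n → ℕ → Set
Regular G d = ∀ v → degree G v ≡ d

Complete : ∀ {n} → SimpleGraph n → Set
Complete G = ∀ v w → v ≢ w → Adj G v w

-- Vertices of the k-particle graph: subsets of size k.
KSubset : ℕ → ℕ → Set
KSubset n k = Σ (Subset n) (λ s → ∣ s ∣ ≡ k)

-- Adjacency in the k-particle graph: s △ t = {v, w} with ⟨v,w⟩ ∈ E.
-- (v ∈ s \ t, w ∈ t \ s, and s, t agree on every other vertex.)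
ParticleAdj : ∀ {n} → SimpleGraph n → Subset n → Subset n → Set
ParticleAdj {n} G s t =
  ∃ λ (v : Fin n) → ∃ λ (w : Fin n) →
    Adj G v w × v ∈ s × v ∉ t × w ∈ t × w ∉ s ×
    (∀ u → u ≢ v → u ≢ w → (u ∈ s ⇔ u ∈ t))

Clique : {V : Set} → (V → V → Set) → ℕ → Set
Clique {V} R c = Σ (Fin c → V) λ f →
  (∀ i j → f i ≡ f j → i ≡ j) × (∀ i j → i ≢ j → R (f i) (f j))

HasClique : ∀ {n} → SimpleGraph n → ℕ → Set
HasClique G c = Clique (Adj G) c

ParticleHasClique : ∀ {n} → SimpleGraph n → (k : ℕ) → ℕ → Set
ParticleHasClique {n} G k c =
  Clique {KSubset n k} (λ s t → ParticleAdj G (proj₁ s) (proj₁ t)) c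

{-# OPTIONS --safe #-}
-- In a d-regular graph every closed non-neighbourhood has the same size e + 1, and e ≥ 1
-- unless the graph is complete. Count the non-adjacent pairs (v, y) with v in a c-clique K
-- and y outside K: each v contributes exactly e of them, each y at most e (y is one of its
-- own e + 1 non-neighbours). Hence c·e ≤ (n − c)·e, so c ≤ n − c.
-- If a set B is disjoint from K or contains K, the sets B △ {v} (v ∈ K) pairwise differ in
-- exactly two adjacent vertices, so they form a c-clique of the particle graph at level
-- |B| ± 1. For k ≤ c take B to be k − 1 vertices outside K; for k > c take K together with
-- k + 1 − c vertices outside K. Both choices exist because n − c ≥ c.
module Submission where

open import Defs
open import Data.Nat using (ℕ; zero; suc; _+_; _*_; _∸_; _≤_; _<_; z≤n; s≤s; _≤?_)
open import Data.Nat.Properties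
  using (+-*-semiring; +-commutativeSemigroup; +-comm; +-identityʳ; *-identityʳ; *-zeroʳ; suc-injective
        ; ≤-trans; ≤-reflexive; ≤-pred; n≤1+n; m≤n⇒m≤1+n; <⇒≤; <⇒≱; ≰⇒>
        ; +-mono-≤; +-mono-<-≤; +-mono-≤-<; +-monoʳ-≤; *-monoʳ-≤; *-cancelʳ-≤; +-cancelʳ-≡
        ; m+n∸m≡n; m∸[m∸n]≡n; ∸-monoˡ-≤; ∸-monoʳ-≤; module ≤-Reasoning)
open import Algebra.Properties.Semiring.Sum +-*-semiring
  using (sum; sum-syntax; sum-cong-≗; sum-remove; ∑-distrib-+; ∑-comm; *-distribˡ-sum; *-distribʳ-sum)
open import Algebra.Properties.CommutativeSemigroup +-commutativeSemigroup using (x∙yz≈y∙xz)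
open import Data.Bool using (Bool; true; false; not; _xor_; T)
open import Data.Bool.Properties using (not-¬; T-≡)
open import Data.Fin using (Fin; zero; suc; punchIn)
open import Data.Fin.Properties using (_≟_; any?; punchInᵢ≢i; 0≢1+n)
import Data.Fin.Properties as Fin
open import Data.Fin.Subset using (_∈_; _∉_; ∣_∣)
open import Data.Vec using (tabulate; lookup)
open import Data.Vec.Properties using (lookup∘tabulate; []=⇒lookup; lookup⇒[]=)
import Data.List as List
open import Data.Product using (∃-syntax; _×_; _,_; proj₁; proj₂)
open import Function.Base using (_∘_)
open import Function.Bundles using (Equivalence; mk⇔)
open import Function.Definitions using (Injective)
open import Relation.Nullary using (¬_; does; yes; no; contradiction)
open import Relation.Nullary.Decidable using (T?; dec-true; dec-false)
open import Relation.Binary.PropositionalEquality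

χ : Bool → ℕ
χ true  = 1
χ false = 0

card : ∀ {n} → (Fin n → Bool) → ℕ
card {n} p = ∑[ x < n ] χ (p x)

∑-const : ∀ n a → ∑[ i < n ] a ≡ n * a
∑-const zero    a = refl
∑-const (suc n) a = cong (a +_) (∑-const n a)

∑-mono-≤ : ∀ {n} {f g : Fin n → ℕ} → (∀ i → f i ≤ g i) → sum f ≤ sum g
∑-mono-≤ {zero}  f≤g = z≤n
∑-mono-≤ {suc n} f≤g = +-mono-≤ (f≤g zero) (∑-mono-≤ (f≤g ∘ suc))

∑-mono-< : ∀ {n} {f g : Fin n → ℕ} → (∀ i → f i ≤ g i) → ∀ j → f j < g j → sum f < sum g
∑-mono-< f≤g zero    fj<gj = +-mono-<-≤ fj<gj (∑-mono-≤ (f≤g ∘ suc))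
∑-mono-< f≤g (suc j) fj<gj = +-mono-≤-< (f≤g zero) (∑-mono-< (f≤g ∘ suc) j fj<gj)

∑-indicator : ∀ {n} (x : Fin n) (g : Fin n → ℕ) → ∑[ y < n ] (χ (does (x ≟ y)) * g y) ≡ g x
∑-indicator {suc n} zero g = begin
  g zero + 0 + ∑[ y < n ] 0  ≡⟨ cong₂ _+_ (+-identityʳ (g zero)) (trans (∑-const n 0) (*-zeroʳ n)) ⟩
  g zero + 0                 ≡⟨ +-identityʳ (g zero) ⟩
  g zero                     ∎
  where open ≡-Reasoning
∑-indicator {suc n} (suc x) g = ∑-indicator x (g ∘ suc)

card-indicator : ∀ {n} (x : Fin n) → card (does ∘ (x ≟_)) ≡ 1
card-indicator x =
  trans (sum-cong-≗ (λ y → sym (*-identityʳ (χ (does (x ≟ y)))))) (∑-indicator x (λ _ → 1))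

∑-split : ∀ {n} (p : Fin n → Bool) (g : Fin n → ℕ) →
          sum g ≡ ∑[ x < n ] (χ (p x) * g x) + ∑[ x < n ] (χ (not (p x)) * g x)
∑-split p g = trans (sum-cong-≗ (λ x → sym (split (p x) (g x))))
                    (∑-distrib-+ (λ x → χ (p x) * g x) (λ x → χ (not (p x)) * g x))
  where
  split : ∀ b m → χ b * m + χ (not b) * m ≡ m
  split true  m = trans (+-identityʳ (m + 0)) (+-identityʳ m)
  split false m = +-identityʳ m

card-∁ : ∀ {n} (p : Fin n → Bool) → card p + card (not ∘ p) ≡ n
card-∁ {n} p = begin
  card p + card (not ∘ p)              ≡⟨ ∑-distrib-+ (χ ∘ p) (χ ∘ not ∘ p) ⟨
  ∑[ x < n ] (χ (p x) + χ (not (p x)))  ≡⟨ sum-cong-≗ (χ+χ-not ∘ p) ⟩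
  ∑[ x < n ] 1                          ≡⟨ ∑-const n 1 ⟩
  n * 1                                 ≡⟨ *-identityʳ n ⟩
  n                                     ∎
  where
  open ≡-Reasoning
  χ+χ-not : ∀ b → χ b + χ (not b) ≡ 1
  χ+χ-not true  = refl
  χ+χ-not false = refl

card-∁-∸ : ∀ {n} (p : Fin n → Bool) → card (not ∘ p) ≡ n ∸ card p
card-∁-∸ p = trans (sym (m+n∸m≡n (card p) _)) (cong (_∸ card p) (card-∁ p))

subset-of-card : ∀ {n} (p : Fin n → Bool) m → m ≤ card p →
                 ∃[ q ] (∀ x → q x ≡ true → p x ≡ true) × card q ≡ m
subset-of-card {zero}  p zero    _ = p , (λ _ px → px) , refl
subset-of-card {suc n} p zero    _ = (λ _ → false) , (λ _ ()) , trans (∑-const (suc n) 0) (*-zeroʳ n)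
subset-of-card {suc n} p (suc m) m<∣p∣ with p zero in p₀
... | true with subset-of-card (p ∘ suc) m (≤-pred m<∣p∣)
...   | q , q⊆p , ∣q∣ =
  (λ { zero → true ; (suc x) → q x }) , (λ { zero _ → p₀ ; (suc x) → q⊆p x }) , cong suc ∣q∣
subset-of-card {suc n} p (suc m) m<∣p∣ | false with subset-of-card (p ∘ suc) (suc m) m<∣p∣
...   | q , q⊆p , ∣q∣ =
  (λ { zero → false ; (suc x) → q x }) , (λ { zero () ; (suc x) → q⊆p x }) , ∣q∣

toggle : ∀ {n} → (Fin n → Bool) → Fin n → Fin n → Bool
toggle B x y = does (x ≟ y) xor B y

toggle-self : ∀ {n} (B : Fin n → Bool) x → toggle B x x ≡ not (B x)
toggle-self B x rewrite dec-true (x ≟ x) refl = refl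

toggle-other : ∀ {n} (B : Fin n → Bool) {x y} → x ≢ y → toggle B x y ≡ B y
toggle-other B {x} {y} x≢y rewrite dec-false (x ≟ y) x≢y = refl

card-toggle : ∀ {n} (B : Fin n → Bool) x → χ (B x) + card (toggle B x) ≡ χ (not (B x)) + card B
card-toggle {suc n} B x = begin
  χ (B x) + card (toggle B x)               ≡⟨ cong (χ (B x) +_) (sum-remove {i = x} (χ ∘ toggle B x)) ⟩
  χ (B x) + (χ (toggle B x x) + rest′)      ≡⟨ cong₂ (λ a r → χ (B x) + (χ a + r)) (toggle-self B x) away ⟩
  χ (B x) + (χ (not (B x)) + rest)          ≡⟨ x∙yz≈y∙xz (χ (B x)) (χ (not (B x))) rest ⟩
  χ (not (B x)) + (χ (B x) + rest)          ≡⟨ cong (χ (not (B x)) +_) (sum-remove {i = x} (χ ∘ B)) ⟨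
  χ (not (B x)) + card B                    ∎
  where
  open ≡-Reasoning
  rest rest′ : ℕ
  rest  = ∑[ j < n ] χ (B (punchIn x j))
  rest′ = ∑[ j < n ] χ (toggle B x (punchIn x j))
  away : rest′ ≡ rest
  away = sum-cong-≗ (λ j → cong χ (toggle-other B (punchInᵢ≢i x j ∘ sym)))

imageᵇ : ∀ {c n} → (Fin c → Fin n) → Fin n → Bool
imageᵇ f y = does (any? λ i → f i ≟ y)

imageᵇ-self : ∀ {c n} (f : Fin c → Fin n) i → imageᵇ f (f i) ≡ true
imageᵇ-self f i = dec-true (any? λ j → f j ≟ f i) (i , refl)

∑-image : ∀ {c n} (f : Fin c → Fin n) → Injective _≡_ _≡_ f → (g : Fin n → ℕ) →
          ∑[ y < n ] (χ (imageᵇ f y) * g y) ≡ ∑[ i < c ] g (f i)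
∑-image {zero}  {n} f _ g = trans (∑-const n 0) (*-zeroʳ n)
∑-image {suc c} {n} f f-inj g = begin
  ∑[ y < n ] (χ (imageᵇ f y) * g y)
    ≡⟨ sum-cong-≗ split ⟩
  ∑[ y < n ] (χ (does (f zero ≟ y)) * g y + χ (imageᵇ (f ∘ suc) y) * g y)
    ≡⟨ ∑-distrib-+ (λ y → χ (does (f zero ≟ y)) * g y) (λ y → χ (imageᵇ (f ∘ suc) y) * g y) ⟩
  ∑[ y < n ] (χ (does (f zero ≟ y)) * g y) + ∑[ y < n ] (χ (imageᵇ (f ∘ suc) y) * g y)
    ≡⟨ cong₂ _+_ (∑-indicator (f zero) g) (∑-image (f ∘ suc) (Fin.suc-injective ∘ f-inj) g) ⟩
  g (f zero) + ∑[ i < c ] g (f (suc i))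
    ∎
  where
  open ≡-Reasoning
  split : ∀ y → χ (imageᵇ f y) * g y ≡ χ (does (f zero ≟ y)) * g y + χ (imageᵇ (f ∘ suc) y) * g y
  split y with f zero ≟ y
  ... | no _       = refl
  ... | yes refl rewrite dec-false (any? λ i → f (suc i) ≟ f zero) (0≢1+n ∘ f-inj ∘ sym ∘ proj₂) =
    sym (+-identityʳ (g (f zero) + 0))

card-image : ∀ {c n} (f : Fin c → Fin n) → Injective _≡_ _≡_ f → card (imageᵇ f) ≡ c
card-image {c} f f-inj = begin
  card (imageᵇ f)                    ≡⟨ sum-cong-≗ (λ y → *-identityʳ (χ (imageᵇ f y))) ⟨
  ∑[ y < _ ] (χ (imageᵇ f y) * 1)    ≡⟨ ∑-image f f-inj (λ _ → 1) ⟩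
  ∑[ i < c ] 1                       ≡⟨ ∑-const c 1 ⟩
  c * 1                              ≡⟨ *-identityʳ c ⟩
  c                                  ∎
  where open ≡-Reasoning

length-filter-tabulate : ∀ {m n} (p : Fin n → Bool) (g : Fin m → Fin n) →
                         List.length (List.filter (T? ∘ p) (List.tabulate g)) ≡ ∑[ i < m ] χ (p (g i))
length-filter-tabulate {zero}  p g = refl
length-filter-tabulate {suc m} p g with p (g zero)
... | true  = cong suc (length-filter-tabulate p (g ∘ suc))
... | false = length-filter-tabulate p (g ∘ suc)

∣tabulate∣ : ∀ {n} (p : Fin n → Bool) → ∣ tabulate p ∣ ≡ card p
∣tabulate∣ {zero}  p = refl
∣tabulate∣ {suc n} p with p zero
... | true  = cong suc (∣tabulate∣ (p ∘ suc))
... | false = ∣tabulate∣ (p ∘ suc)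

∈-tabulate⁺ : ∀ {n} {p : Fin n → Bool} {x} → p x ≡ true → x ∈ tabulate p
∈-tabulate⁺ {p = p} {x} px = lookup⇒[]= x (tabulate p) (trans (lookup∘tabulate p x) px)

∈-tabulate⁻ : ∀ {n} {p : Fin n → Bool} {x} → x ∈ tabulate p → p x ≡ true
∈-tabulate⁻ {p = p} {x} x∈p = trans (sym (lookup∘tabulate p x)) ([]=⇒lookup x∈p)

∉-tabulate⁺ : ∀ {n} {p : Fin n → Bool} {x} → p x ≡ false → x ∉ tabulate p
∉-tabulate⁺ px x∈p with trans (sym px) (∈-tabulate⁻ x∈p)
... | ()

particleAdj-tabulate : ∀ {n} (G : SimpleGraph n) {s t : Fin n → Bool} {v w} → Adj G v w →
                       s v ≡ true → t v ≡ false → t w ≡ true → s w ≡ false →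
                       (∀ u → u ≢ v → u ≢ w → s u ≡ t u) →
                       ParticleAdj G (tabulate s) (tabulate t)
particleAdj-tabulate G {v = v} {w} vw sv tv tw sw agree =
  v , w , vw , ∈-tabulate⁺ sv , ∉-tabulate⁺ tv , ∈-tabulate⁺ tw , ∉-tabulate⁺ sw ,
  λ u u≢v u≢w → mk⇔ (∈-tabulate⁺ ∘ trans (sym (agree u u≢v u≢w)) ∘ ∈-tabulate⁻)
                    (∈-tabulate⁺ ∘ trans (agree u u≢v u≢w) ∘ ∈-tabulate⁻)

particleAdj-swap : ∀ {n} (G : SimpleGraph n) {s t : Fin n → Bool} {v w} b → Adj G v w →
                   s v ≡ not b → t w ≡ not b → s w ≡ b → t v ≡ b →
                   (∀ u → u ≢ v → u ≢ w → s u ≡ t u) →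
                   ParticleAdj G (tabulate s) (tabulate t)
particleAdj-swap G false vw sv tw sw tv agree = particleAdj-tabulate G vw sv tv tw sw agree
particleAdj-swap G {v = v} {w} true vw sv tw sw tv agree =
  particleAdj-tabulate G (subst T (symmetric G v w) vw) sw tw tv sv (λ u u≢w u≢v → agree u u≢v u≢w)

nonNbr : ∀ {n} → SimpleGraph n → Fin n → Fin n → Bool
nonNbr G v w = not (adj G v w)

nonNbr-self : ∀ {n} (G : SimpleGraph n) v → nonNbr G v v ≡ true
nonNbr-self G v = cong not (irrefl G v)

nonNbr-sym : ∀ {n} (G : SimpleGraph n) v w → nonNbr G v w ≡ nonNbr G w v
nonNbr-sym G v w = cong not (symmetric G v w)

degree+card-nonNbr : ∀ {n} (G : SimpleGraph n) v → degree G v + card (nonNbr G v) ≡ n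
degree+card-nonNbr {n} G v =
  trans (cong (_+ card (nonNbr G v)) (length-filter-tabulate (adj G v) (λ w → w))) (card-∁ (adj G v))

card-nonNbr-regular : ∀ {n d} (G : SimpleGraph n) → Regular G d → ∀ v → card (nonNbr G v) ≡ n ∸ d
card-nonNbr-regular {d = d} G reg v = begin
  card (nonNbr G v)                      ≡⟨ m+n∸m≡n d _ ⟨
  d + card (nonNbr G v) ∸ d              ≡⟨ cong (λ e → e + card (nonNbr G v) ∸ d) (reg v) ⟨
  degree G v + card (nonNbr G v) ∸ d     ≡⟨ cong (_∸ d) (degree+card-nonNbr G v) ⟩
  _ ∸ d                                  ∎
  where open ≡-Reasoning

complete-if-card-nonNbr≤1 : ∀ {n} (G : SimpleGraph n) → (∀ v → card (nonNbr G v) ≤ 1) → Complete G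
complete-if-card-nonNbr≤1 G small v w v≢w with adj G v w in vw
... | true  = _
... | false = <⇒≱ two≤ (small v)
  where
  below : ∀ y → χ (does (v ≟ y)) ≤ χ (nonNbr G v y)
  below y with v ≟ y
  ... | yes refl = ≤-reflexive (cong χ (sym (nonNbr-self G v)))
  ... | no _     = z≤n
  at-w : χ (does (v ≟ w)) < χ (nonNbr G v w)
  at-w rewrite dec-false (v ≟ w) v≢w | vw = s≤s z≤n
  two≤ : 1 < card (nonNbr G v)
  two≤ = subst (_< card (nonNbr G v)) (card-indicator v) (∑-mono-< below w at-w)

module _ {n c} (G : SimpleGraph n) (f : Fin c → Fin n)
         (f-inj : ∀ i j → f i ≡ f j → i ≡ j) (f-clique : ∀ i j → i ≢ j → Adj G (f i) (f j)) where

  private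
    K : Fin n → Bool
    K = imageᵇ f

    K-inj : Injective _≡_ _≡_ f
    K-inj {i} {j} = f-inj i j

  nonNbr-on-clique : ∀ i j → nonNbr G (f i) (f j) ≡ does (i ≟ j)
  nonNbr-on-clique i j with i ≟ j
  ... | yes refl = nonNbr-self G (f i)
  ... | no i≢j   = cong not (Equivalence.to T-≡ (f-clique i j i≢j))

  clique-nonNbr-inside : ∀ i → ∑[ y < n ] (χ (K y) * χ (nonNbr G (f i) y)) ≡ 1
  clique-nonNbr-inside i = begin
    ∑[ y < n ] (χ (K y) * χ (nonNbr G (f i) y))  ≡⟨ ∑-image f K-inj (χ ∘ nonNbr G (f i)) ⟩
    ∑[ j < c ] χ (nonNbr G (f i) (f j))          ≡⟨ sum-cong-≗ (cong χ ∘ nonNbr-on-clique i) ⟩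
    card (does ∘ (i ≟_))                         ≡⟨ card-indicator i ⟩
    1                                            ∎
    where open ≡-Reasoning

  module _ {e} (codegree : ∀ v → card (nonNbr G v) ≡ suc e) where

    clique-nonNbr-outside : ∀ i → ∑[ y < n ] (χ (not (K y)) * χ (nonNbr G (f i) y)) ≡ e
    clique-nonNbr-outside i = suc-injective (begin
      1 + outside                                            ≡⟨ cong (_+ outside) (clique-nonNbr-inside i) ⟨
      ∑[ y < n ] (χ (K y) * χ (nonNbr G (f i) y)) + outside  ≡⟨ ∑-split K (χ ∘ nonNbr G (f i)) ⟨
      card (nonNbr G (f i))                                  ≡⟨ codegree (f i) ⟩
      suc e                                                  ∎)
      where
      open ≡-Reasoning
      outside : ℕ
      outside = ∑[ y < n ] (χ (not (K y)) * χ (nonNbr G (f i) y))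

    outside-nonNbr-clique : ∀ y → K y ≡ false → ∑[ i < c ] χ (nonNbr G (f i) y) ≤ e
    outside-nonNbr-clique y y∉K = ≤-pred (begin-strict
      ∑[ i < c ] χ (nonNbr G (f i) y)               ≡⟨ sum-cong-≗ (λ i → cong χ (nonNbr-sym G (f i) y)) ⟩
      ∑[ i < c ] χ (nonNbr G y (f i))               ≡⟨ ∑-image f K-inj (χ ∘ nonNbr G y) ⟨
      ∑[ x < n ] (χ (K x) * χ (nonNbr G y x))       <⟨ ∑-mono-< (λ x → χ*-≤ (K x) _) y at-y ⟩
      card (nonNbr G y)                             ≡⟨ codegree y ⟩
      suc e                                         ∎)
      where
      open ≤-Reasoning
      χ*-≤ : ∀ b m → χ b * m ≤ m
      χ*-≤ true  m = ≤-reflexive (+-identityʳ m)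
      χ*-≤ false m = z≤n
      at-y : χ (K y) * χ (nonNbr G y y) < χ (nonNbr G y y)
      at-y rewrite y∉K | nonNbr-self G y = s≤s z≤n

    clique≤outside : c * e ≤ card (not ∘ K) * e
    clique≤outside = begin
      c * e                                                     ≡⟨ ∑-const c e ⟨
      ∑[ i < c ] e                                              ≡⟨ sum-cong-≗ clique-nonNbr-outside ⟨
      ∑[ i < c ] ∑[ y < n ] (χ (not (K y)) * χ (nonNbr G (f i) y))
                                                                ≡⟨ ∑-comm (λ i y → χ (not (K y)) * χ (nonNbr G (f i) y)) ⟩
      ∑[ y < n ] ∑[ i < c ] (χ (not (K y)) * χ (nonNbr G (f i) y))
                                                                ≡⟨ sum-cong-≗ factor ⟨
      ∑[ y < n ] (χ (not (K y)) * ∑[ i < c ] χ (nonNbr G (f i) y))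
                                                                ≤⟨ ∑-mono-≤ bound ⟩
      ∑[ y < n ] (χ (not (K y)) * e)                            ≡⟨ *-distribʳ-sum e (χ ∘ not ∘ K) ⟨
      card (not ∘ K) * e                                        ∎
      where
      open ≤-Reasoning
      factor : ∀ y → χ (not (K y)) * ∑[ i < c ] χ (nonNbr G (f i) y)
                   ≡ ∑[ i < c ] (χ (not (K y)) * χ (nonNbr G (f i) y))
      factor y = *-distribˡ-sum (χ (not (K y))) (λ i → χ (nonNbr G (f i) y))
      bound : ∀ y → χ (not (K y)) * ∑[ i < c ] χ (nonNbr G (f i) y) ≤ χ (not (K y)) * e
      bound y with K y in Ky
      ... | true  = z≤n
      ... | false = *-monoʳ-≤ 1 (outside-nonNbr-clique y Ky)

  clique-half : ∀ {d} → Regular G d → ¬ Complete G → c + c ≤ n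
  clique-half {d} reg ¬complete = from-codegree (n ∸ d) (card-nonNbr-regular G reg)
    where
    from-codegree : ∀ e → (∀ v → card (nonNbr G v) ≡ e) → c + c ≤ n
    from-codegree 0 codegree =
      contradiction (complete-if-card-nonNbr≤1 G (λ v → ≤-trans (≤-reflexive (codegree v)) z≤n)) ¬complete
    from-codegree 1 codegree =
      contradiction (complete-if-card-nonNbr≤1 G (≤-reflexive ∘ codegree)) ¬complete
    from-codegree (suc (suc e)) codegree = begin
      c + c                    ≤⟨ +-monoʳ-≤ c (*-cancelʳ-≤ c _ (suc e) (clique≤outside codegree)) ⟩
      c + card (not ∘ K)       ≡⟨ cong (_+ card (not ∘ K)) (card-image f K-inj) ⟨
      card K + card (not ∘ K)  ≡⟨ card-∁ K ⟩
      n                        ∎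
      where open ≤-Reasoning

  toggle-particleClique : ∀ B b → (∀ i → B (f i) ≡ b) →
                          ∀ k → card B + χ (not b) ≡ k + χ b → ParticleHasClique G k c
  toggle-particleClique B b B-on-clique k ∣B∣ = vertex , vertex-inj , vertex-adj
    where
    toggled : Fin c → Fin n → Bool
    toggled i = toggle B (f i)

    f≢ : ∀ {i j} → i ≢ j → f i ≢ f j
    f≢ {i} {j} i≢j = i≢j ∘ f-inj i j

    at-self : ∀ i → toggled i (f i) ≡ not b
    at-self i = trans (toggle-self B (f i)) (cong not (B-on-clique i))

    at-other : ∀ {i j} → i ≢ j → toggled i (f j) ≡ b
    at-other i≢j = trans (toggle-other B (f≢ i≢j)) (B-on-clique _)

    elsewhere : ∀ i j u → u ≢ f i → u ≢ f j → toggled i u ≡ toggled j u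
    elsewhere i j u u≢fi u≢fj = trans (toggle-other B (u≢fi ∘ sym)) (sym (toggle-other B (u≢fj ∘ sym)))

    size : ∀ i → ∣ tabulate (toggled i) ∣ ≡ k
    size i = +-cancelʳ-≡ (χ b) _ k (begin
      ∣ tabulate (toggled i) ∣ + χ b  ≡⟨ cong₂ _+_ (∣tabulate∣ (toggled i)) (cong χ (sym (B-on-clique i))) ⟩
      card (toggled i) + χ (B (f i))  ≡⟨ +-comm _ (χ (B (f i))) ⟩
      χ (B (f i)) + card (toggled i)  ≡⟨ card-toggle B (f i) ⟩
      χ (not (B (f i))) + card B      ≡⟨ cong (λ a → χ (not a) + card B) (B-on-clique i) ⟩
      χ (not b) + card B              ≡⟨ +-comm (χ (not b)) (card B) ⟩
      card B + χ (not b)              ≡⟨ ∣B∣ ⟩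
      k + χ b                         ∎)
      where open ≡-Reasoning

    vertex : Fin c → KSubset n k
    vertex i = tabulate (toggled i) , size i

    vertex-inj : ∀ i j → vertex i ≡ vertex j → i ≡ j
    vertex-inj i j eq with i ≟ j
    ... | yes i≡j = i≡j
    ... | no i≢j  = contradiction b≡not-b (not-¬ refl)
      where
      b≡not-b : b ≡ not b
      b≡not-b = begin
        b                                        ≡⟨ at-other (i≢j ∘ sym) ⟨
        toggled j (f i)                          ≡⟨ lookup∘tabulate (toggled j) (f i) ⟨
        lookup (proj₁ (vertex j)) (f i)          ≡⟨ cong (λ s → lookup (proj₁ s) (f i)) eq ⟨
        lookup (proj₁ (vertex i)) (f i)          ≡⟨ lookup∘tabulate (toggled i) (f i) ⟩
        toggled i (f i)                          ≡⟨ at-self i ⟩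
        not b                                    ∎
        where open ≡-Reasoning

    vertex-adj : ∀ i j → i ≢ j → ParticleAdj G (tabulate (toggled i)) (tabulate (toggled j))
    vertex-adj i j i≢j =
      particleAdj-swap G b (f-clique i j i≢j) (at-self i) (at-self j) (at-other i≢j) (at-other (i≢j ∘ sym))
        (elsewhere i j)

  off-clique : ∀ {T : Fin n → Bool} → (∀ x → T x ≡ true → not (K x) ≡ true) → ∀ i → T (f i) ≡ false
  off-clique {T} T⊆∁K i with T (f i) in Tfi
  ... | false = refl
  ... | true  = contradiction (trans (sym (T⊆∁K (f i) Tfi)) (cong not (imageᵇ-self f i))) λ ()

  particleClique-insert : ∀ {k} → k ≤ card (not ∘ K) → ParticleHasClique G (suc k) c
  particleClique-insert {k} k≤∣∁K∣ with subset-of-card (not ∘ K) k k≤∣∁K∣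
  ... | T , T⊆∁K , ∣T∣ = toggle-particleClique T false (off-clique T⊆∁K) (suc k) (begin
    card T + 1    ≡⟨ +-comm (card T) 1 ⟩
    suc (card T)  ≡⟨ cong suc ∣T∣ ⟩
    suc k         ≡⟨ +-identityʳ (suc k) ⟨
    suc k + 0     ∎)
    where open ≡-Reasoning

  particleClique-delete : ∀ {k} → n ∸ suc k ≤ card (not ∘ K) → k < n → ParticleHasClique G k c
  particleClique-delete {k} ≤∣∁K∣ k<n with subset-of-card (not ∘ K) (n ∸ suc k) ≤∣∁K∣
  ... | T , T⊆∁K , ∣T∣ = toggle-particleClique (not ∘ T) true (cong not ∘ off-clique T⊆∁K) k (begin
    card (not ∘ T) + 0   ≡⟨ +-identityʳ _ ⟩
    card (not ∘ T)       ≡⟨ card-∁-∸ T ⟩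
    n ∸ card T           ≡⟨ cong (n ∸_) ∣T∣ ⟩
    n ∸ (n ∸ suc k)      ≡⟨ m∸[m∸n]≡n k<n ⟩
    suc k                ≡⟨ +-comm 1 k ⟩
    k + 1                ∎)
    where open ≡-Reasoning

  card-∁-image : card (not ∘ K) ≡ n ∸ c
  card-∁-image = trans (card-∁-∸ K) (cong (n ∸_) (card-image f K-inj))

  particleClique : ∀ {k} → c + c ≤ n → 1 ≤ k → k < n → ParticleHasClique G k c
  particleClique {suc k} c+c≤n _ k<n with suc k ≤? c
  ... | yes k<c = particleClique-insert (begin
    k               ≤⟨ n≤1+n k ⟩
    suc k           ≤⟨ k<c ⟩
    c               ≡⟨ m+n∸m≡n c c ⟨
    c + c ∸ c       ≤⟨ ∸-monoˡ-≤ c c+c≤n ⟩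
    n ∸ c           ≡⟨ card-∁-image ⟨
    card (not ∘ K)  ∎)
    where open ≤-Reasoning
  ... | no k≮c = particleClique-delete
    (≤-trans (∸-monoʳ-≤ n (m≤n⇒m≤1+n (<⇒≤ (≰⇒> k≮c)))) (≤-reflexive (sym card-∁-image))) k<n

corollary3p6 : (n d k c : ℕ) → (G : SimpleGraph n) → Connected G →
    1 ≤ k → k < n →
    Regular G d → ¬ Complete G → HasClique G c →
    ParticleHasClique G k c
corollary3p6 n d k c G _ 1≤k k<n regular ¬complete (f , f-inj , f-clique) =
  particleClique G f f-inj f-clique (clique-half G f f-inj f-clique regular ¬complete) 1≤k k<n
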